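{- Let $\Lambda$ be a finite distributive lattice, with least element $\mathbb{0}$ and greatest element $\mathbb{1}$. Fix $n\ge 0$ and, for each $i\in\{1,\dots,n\}$, a pair $E_i\le F_i$ of elements of $\Lambda$ with $E_i$ meet-irreducible. Let $\mathcal{A}^*$ be the class of all finite structures $(A,d,\{<_{E_i}\}_{i=1}^n)$ such that $(A,d)$ is a $\Lambda$-ultrametric space and, for each $i$, $<_{E_i}$ is a subquotient order on $A$ with bottom relation $E_i$ and top relation $F_i$. Then $\mathcal{A}^*$ is an amalgamation class: whenever $A_0,A_1,A_2\in\mathcal{A}^*$ and $f_j:A_0\to A_j$ ($j=1,2$) are embeddings, there are $C\in\mathcal{A}^*$ and embeddings $g_j:A_j\to C$ with $g_1\circ f_1=g_2\circ f_2$.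
   Context: A $\Lambda$-ultrametric space is a set $X$ with a function $d:X\times X\to\Lambda$ such that $d(x,y)=\mathbb{0}$ iff $x=y$, $d(x,y)=d(y,x)$, and $d(x,z)\le d(x,y)\vee d(y,z)$ for all $x,y,z$. It is viewed as a relational structure with one binary relation for each possible distance. Each $\lambda\in\Lambda$ is identified with the equivalence relation $\{(x,y): d(x,y)\le\lambda\}$ on $X$. An element $x\in\Lambda$ is meet-irreducible if there do not exist $y,z\neq x$ with $x=y\wedge z$. For equivalence relations $E\le F$ on $X$, a subquotient order from $E$ to $F$ (bottom relation $E$, top relation $F$) is a partial order on $X/E$ in which two $E$-classes are comparable iff they lie in the same $F$-class; it is also regarded as the pulled-back partial order on $X$. Embeddings preserve $d$ and all the subquotient orders in both directions. -}

module Defs where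

open import Level using (0ℓ)
open import Data.Nat using (ℕ)
open import Data.Fin using (Fin)
open import Data.Product using (Σ; _×_; ∃-syntax)
open import Data.Sum using (_⊎_)
open import Relation.Nullary using (¬_)
open import Relation.Binary.Bundles using (Setoid)
open import Relation.Binary.Definitions using (Minimum; Maximum)
open import Relation.Binary.Lattice.Bundles using (DistributiveLattice)
import Relation.Binary.PropositionalEquality as ≡
open ≡ using (_≡_)
open import Function.Bundles using (Inverse; _⇔_)

record FiniteDistLattice : Set₁ where
  field
    distLattice : DistributiveLattice 0ℓ 0ℓ 0ℓ
  open DistributiveLattice distLattice public
  field
    𝟘       : Carrier
    𝟙       : Carrier
    𝟘-least : Minimum _≤_ 𝟘
    𝟙-great : Maximum _≤_ 𝟙
    finite  : Σ ℕ λ m → Inverse setoid (≡.setoid (Fin m))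

module _ (Λ : FiniteDistLattice) where
  open FiniteDistLattice Λ

  MeetIrreducible : Carrier → Set
  MeetIrreducible x =
    ¬ (∃[ y ] ∃[ z ] (¬ (y ≈ x) × ¬ (z ≈ x) × (x ≈ (y ∧ z))))

  record IsUltrametric {X : Set} (d : X → X → Carrier) : Set where
    field
      zero-iff : ∀ x y → (d x y ≈ 𝟘) ⇔ (x ≡ y)
      symm     : ∀ x y → d x y ≈ d y x
      ultra    : ∀ x y z → d x z ≤ (d x y ∨ d y z)

  -- The equivalence relation on X identified with λ ∈ Λ.
  EqRel : {X : Set} → (X → X → Carrier) → Carrier → X → X → Set
  EqRel d l x y = d x y ≤ l

  -- A subquotient order from e to f, presented as the pulled-back
  -- strict partial order < on X: it is well defined on e-classes,
  -- it is a strict partial order on X/e, and two e-classes are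
  -- comparable iff they lie in the same f-class.
  record IsSubquotientOrder {X : Set} (d : X → X → Carrier) (e f : Carrier)
                            (_<_ : X → X → Set) : Set where
    field
      respects : ∀ x x′ y y′ → EqRel d e x x′ → EqRel d e y y′ →
                 x < y → x′ < y′
      irrefl   : ∀ x y → x < y → ¬ EqRel d e x y
      trans    : ∀ x y z → x < y → y < z → x < z
      within   : ∀ x y → x < y → EqRel d f x y
      total    : ∀ x y → EqRel d f x y → EqRel d e x y ⊎ (x < y ⊎ y < x)

  module _ (n : ℕ) (E F : Fin n → Carrier) where

    record Str : Set₁ where
      field
        size   : ℕ
        d      : Fin size → Fin size → Carrier
        isUltra : IsUltrametric d
        ord    : Fin n → Fin size → Fin size → Set
        isSQ   : ∀ i → IsSubquotientOrder d (E i) (F i) (ord i)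
    open Str public

    record Embedding (A B : Str) : Set where
      field
        fun     : Fin (size A) → Fin (size B)
        d-pres  : ∀ x y → d B (fun x) (fun y) ≈ d A x y
        ord-pres : ∀ i x y → ord A i x y ⇔ ord B i (fun x) (fun y)
    open Embedding public

    Amalgamation : Set₁
    Amalgamation =
      (A₀ A₁ A₂ : Str) (f₁ : Embedding A₀ A₁) (f₂ : Embedding A₀ A₂) →
      Σ Str λ C → Σ (Embedding A₁ C) λ g₁ → Σ (Embedding A₂ C) λ g₂ →
        ∀ x → fun g₁ (fun f₁ x) ≡ fun g₂ (fun f₂ x)

module Submission where

-- Given embeddings f₁ : A₀ → A₁ and f₂ : A₀ → A₂, glue A₁ and A₂ along A₀.
-- The distance between x ∈ A₁ and y ∈ A₂ is the shortest route through A₀,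
--   cross x y = ⋀ₐ ( d₁ x (f₁ a) ∨ d₂ (f₂ a) y ),
-- which makes the disjoint union A₁ ⊎ A₂ a pseudo-ultrametric space in which
-- f₁ a and f₂ a are at distance 𝟘.  For each i, x and y at cross distance in
-- (Eᵢ , Fᵢ] are ordered by putting y below x exactly when y ⊑ f₂ a and f₁ a ⊑ x
-- for some a ∈ A₀.  The point where meet-irreducibility is used: in a
-- distributive lattice a meet-irreducible element is meet-prime, so
-- cross x y ≤ Eᵢ forces x and y to be Eᵢ-close to the two images of one a ∈ A₀;
-- this makes the new orders transitive and well defined on Eᵢ-classes.
-- Finally, identifying points at distance 𝟘 turns this pseudo-structure into a
-- member of 𝒜* into which A₁ and A₂ embed compatibly.

open import Defs
open import Data.Nat using (ℕ; zero; suc; _+_)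
open import Data.Fin using (Fin; zero; suc; splitAt; join)
import Data.Fin as Fin
open import Data.Fin.Properties using (any?; splitAt-join)
open import Data.Product using (_×_; _,_; proj₁; proj₂; ∃-syntax)
open import Data.Sum using (_⊎_; inj₁; inj₂)
open import Data.Empty using (⊥; ⊥-elim)
open import Relation.Nullary using (¬_; Dec; yes; no)
open import Relation.Nullary.Decidable using (_×-dec_)
import Relation.Binary.PropositionalEquality as ≡
open ≡ using (_≡_)
open import Function.Bundles using (Inverse; Equivalence; _⇔_; mk⇔)
open import Function using (_∘_; id)

module LatticeFacts (Λ : FiniteDistLattice) where
  open FiniteDistLattice Λ
  open import Relation.Binary.Lattice.Properties.DistributiveLattice distLattice
    using (∨-distribʳ-∧)

  private
    module Enum = Inverse (proj₂ finite)

  -- Equality in Λ is decidable, because Λ is in bijection with some Fin m.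
  ≈-dec : ∀ x y → Dec (x ≈ y)
  ≈-dec x y with Enum.to x Fin.≟ Enum.to y
  ... | yes eq = yes (Eq.trans (Eq.sym (Enum.strictlyInverseʳ x))
                       (Eq.trans (Enum.from-cong eq) (Enum.strictlyInverseʳ y)))
  ... | no ne = no (λ p → ne (Enum.to-cong p))

  -- Hence so is the order, as x ≤ y iff x ∧ y ≈ x.
  ≤-dec : ∀ x y → Dec (x ≤ y)
  ≤-dec x y with ≈-dec (x ∧ y) x
  ... | yes p = yes (trans (reflexive (Eq.sym p)) (x∧y≤y x y))
  ... | no ne = no (λ le → ne (antisym (x∧y≤x x y) (∧-greatest refl le)))

  ≤𝟘⇒≈𝟘 : ∀ {x} → x ≤ 𝟘 → x ≈ 𝟘
  ≤𝟘⇒≈𝟘 {x} h = antisym h (𝟘-least x)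

  ≤∨ˡ : ∀ {u p q} → u ≤ p → u ≤ p ∨ q
  ≤∨ˡ {q = q} h = trans h (x≤x∨y _ q)

  ≤∨ʳ : ∀ {u p q} → u ≤ q → u ≤ p ∨ q
  ≤∨ʳ {p = p} h = trans h (y≤x∨y p _)

  ∨-bound : ∀ {u p q c} → u ≤ p ∨ q → p ≤ c → q ≤ c → u ≤ c
  ∨-bound h a b = trans h (∨-least a b)

  ≤∨-swap : ∀ {c} x y → c ≤ x ∨ y → c ≤ y ∨ x
  ≤∨-swap x y h = ∨-bound h (y≤x∨y y x) (x≤x∨y y x)

  MeetPrime : Carrier → Set
  MeetPrime e = ∀ y z → y ∧ z ≤ e → y ≤ e ⊎ z ≤ e

  -- In a distributive lattice meet-irreducible elements are meet-prime:
  -- if y ∧ z ≤ e with y , z ≰ e then e = (y ∨ e) ∧ (z ∨ e) splits e.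
  meetIrreducible⇒meetPrime : ∀ e → MeetIrreducible Λ e → MeetPrime e
  meetIrreducible⇒meetPrime e irred y z y∧z≤e with ≈-dec (y ∨ e) e | ≈-dec (z ∨ e) e
  ... | yes p | _     = inj₁ (trans (x≤x∨y y e) (reflexive p))
  ... | no _  | yes q = inj₂ (trans (x≤x∨y z e) (reflexive q))
  ... | no p  | no q  = ⊥-elim (irred (y ∨ e , z ∨ e , p , q , split))
    where
    split : e ≈ (y ∨ e) ∧ (z ∨ e)
    split = antisym (∧-greatest (y≤x∨y y e) (y≤x∨y z e))
                    (trans (reflexive (Eq.sym (∨-distribʳ-∧ e y z))) (∨-least y∧z≤e refl))

  ⋀ : ∀ {k} → (Fin k → Carrier) → Carrier
  ⋀ {zero} g = 𝟙
  ⋀ {suc k} g = g zero ∧ ⋀ (g ∘ suc)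

  ⋀-lowerBound : ∀ {k} (g : Fin k → Carrier) a → ⋀ g ≤ g a
  ⋀-lowerBound g zero = x∧y≤x _ _
  ⋀-lowerBound g (suc a) = trans (x∧y≤y _ _) (⋀-lowerBound (g ∘ suc) a)

  ⋀-∨-bound : ∀ {k} (g : Fin k → Carrier) c x →
              (∀ a → c ≤ g a ∨ x) → c ≤ ⋀ g ∨ x
  ⋀-∨-bound {zero} g c x h = trans (𝟙-great c) (x≤x∨y 𝟙 x)
  ⋀-∨-bound {suc k} g c x h =
    trans (∧-greatest (h zero) (⋀-∨-bound (g ∘ suc) c x (h ∘ suc)))
          (reflexive (Eq.sym (∨-distribʳ-∧ x (g zero) (⋀ (g ∘ suc)))))

  ⋀-prime : ∀ {k} e → MeetPrime e → (g : Fin k → Carrier) → ⋀ g ≤ e →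
            (∃[ a ] g a ≤ e) ⊎ 𝟙 ≤ e
  ⋀-prime {zero} e prime g h = inj₂ h
  ⋀-prime {suc k} e prime g h with prime _ _ h
  ... | inj₁ p = inj₁ (zero , p)
  ... | inj₂ p with ⋀-prime e prime (g ∘ suc) p
  ...   | inj₁ (a , q) = inj₁ (suc a , q)
  ...   | inj₂ q = inj₂ q

record FiniteQuotient (N : ℕ) (R : Fin N → Fin N → Set) : Set where
  field
    classes       : ℕ
    class         : Fin N → Fin classes
    rep           : Fin classes → Fin N
    rep-class     : ∀ p → R (rep (class p)) p
    rep-injective : ∀ c c′ → R (rep c) (rep c′) → c ≡ c′

finiteQuotient : ∀ N (R : Fin N → Fin N → Set) → (∀ x y → Dec (R x y)) →
                 (∀ x → R x x) → (∀ x y → R x y → R y x) →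
                 (∀ x y z → R x y → R y z → R x z) → FiniteQuotient N R
finiteQuotient zero R dec rfl sym trn =
  record { classes = zero ; class = λ () ; rep = λ () ; rep-class = λ () ; rep-injective = λ () }
finiteQuotient (suc N) R dec rfl sym trn
  with finiteQuotient N (λ x y → R (suc x) (suc y)) (λ x y → dec (suc x) (suc y))
         (λ x → rfl (suc x)) (λ x y → sym (suc x) (suc y))
         (λ x y z → trn (suc x) (suc y) (suc z))
     | any? (λ p → dec (suc p) zero)
... | Q | yes (p , Rp0) = record
  { classes = classes ; class = class′ ; rep = suc ∘ rep ; rep-class = rep-class′
  ; rep-injective = rep-injective }
  where
  open FiniteQuotient Q
  class′ : Fin (suc N) → Fin classes
  class′ zero = class p
  class′ (suc x) = class x
  rep-class′ : ∀ x → R (suc (rep (class′ x))) x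
  rep-class′ zero = trn _ _ _ (rep-class p) Rp0
  rep-class′ (suc x) = rep-class x
... | Q | no isolated = record
  { classes = suc classes ; class = class′ ; rep = rep′ ; rep-class = rep-class′
  ; rep-injective = rep-injective′ }
  where
  open FiniteQuotient Q
  class′ : Fin (suc N) → Fin (suc classes)
  class′ zero = zero
  class′ (suc x) = suc (class x)
  rep′ : Fin (suc classes) → Fin (suc N)
  rep′ zero = zero
  rep′ (suc c) = suc (rep c)
  rep-class′ : ∀ x → R (rep′ (class′ x)) x
  rep-class′ zero = rfl zero
  rep-class′ (suc x) = rep-class x
  rep-injective′ : ∀ c c′ → R (rep′ c) (rep′ c′) → c ≡ c′
  rep-injective′ zero zero h = ≡.refl
  rep-injective′ zero (suc c′) h = ⊥-elim (isolated (rep c′ , sym _ _ h))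
  rep-injective′ (suc c) zero h = ⊥-elim (isolated (rep c , h))
  rep-injective′ (suc c) (suc c′) h = ≡.cong suc (rep-injective c c′ h)

module PseudoUltrametrics (Λ : FiniteDistLattice) where
  open FiniteDistLattice Λ
  open LatticeFacts Λ

  record IsPseudoUltrametric {X : Set} (δ : X → X → Carrier) : Set where
    field
      self  : ∀ x → δ x x ≤ 𝟘
      symm  : ∀ x y → δ x y ≈ δ y x
      ultra : ∀ x y z → δ x z ≤ δ x y ∨ δ y z

  ultrametric⇒pseudo : {X : Set} {δ : X → X → Carrier} →
                       IsUltrametric Λ δ → IsPseudoUltrametric δ
  ultrametric⇒pseudo um = record
    { self  = λ x → reflexive (Equivalence.from (zero-iff x x) ≡.refl)
    ; symm  = symm
    ; ultra = ultra }
    where open IsUltrametric um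

  module Balls {X : Set} {δ : X → X → Carrier} (pu : IsPseudoUltrametric δ) where
    open IsPseudoUltrametric pu

    close-refl : ∀ l x → EqRel Λ δ l x x
    close-refl l x = trans (self x) (𝟘-least l)

    close-sym : ∀ {l x y} → EqRel Λ δ l x y → EqRel Λ δ l y x
    close-sym {x = x} {y} h = trans (reflexive (symm y x)) h

    close-trans : ∀ {l x y z} → EqRel Λ δ l x y → EqRel Λ δ l y z → EqRel Λ δ l x z
    close-trans {x = x} {y} {z} p q = ∨-bound (ultra x y z) p q

    _≐_ : X → X → Set
    _≐_ = EqRel Λ δ 𝟘

    ≐⇒close : ∀ l {x y} → x ≐ y → EqRel Λ δ l x y
    ≐⇒close l h = trans h (𝟘-least l)

    dist-≐ˡ : ∀ {x x′} y → x ≐ x′ → δ x y ≤ δ x′ y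
    dist-≐ˡ {x} {x′} y h = ∨-bound (ultra x x′ y) (≐⇒close _ h) refl

    dist-≐ʳ : ∀ x {y y′} → y ≐ y′ → δ x y ≤ δ x y′
    dist-≐ʳ x {y} {y′} h = ∨-bound (ultra x y′ y) refl (≐⇒close _ (close-sym h))

    dist-≐ : ∀ {x x′ y y′} → x ≐ x′ → y ≐ y′ → δ x y ≈ δ x′ y′
    dist-≐ {x} {x′} {y} {y′} hx hy = antisym
      (trans (dist-≐ˡ y hx) (dist-≐ʳ x′ hy))
      (trans (dist-≐ˡ y′ (close-sym hx)) (dist-≐ʳ x (close-sym hy)))

    -- x and y are l-close but not k-close; for a subquotient order from k
    -- to l this means strictly comparable.
    Apart : (k l : Carrier) → X → X → Set
    Apart k l x y = EqRel Λ δ l x y × ¬ EqRel Λ δ k x y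

    apart-congˡ : ∀ {k l x x′ y} → k ≤ l → EqRel Λ δ k x x′ →
                  Apart k l x y → Apart k l x′ y
    apart-congˡ k≤l h (≤l , ≰k) =
      close-trans (close-sym (trans h k≤l)) ≤l , λ h′ → ≰k (close-trans h h′)

    apart-congʳ : ∀ {k l x y y′} → k ≤ l → EqRel Λ δ k y y′ →
                  Apart k l x y → Apart k l x y′
    apart-congʳ k≤l h (≤l , ≰k) =
      close-trans ≤l (trans h k≤l) , λ h′ → ≰k (close-trans h′ (close-sym h))


module SubquotientToolkit (Λ : FiniteDistLattice) {X : Set}
  {δ : X → X → FiniteDistLattice.Carrier Λ}
  (pu : PseudoUltrametrics.IsPseudoUltrametric Λ δ)
  {e f : FiniteDistLattice.Carrier Λ} (e≤f : FiniteDistLattice._≤_ Λ e f)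
  {_<_ : X → X → Set} (sq : IsSubquotientOrder Λ δ e f _<_) where
  open FiniteDistLattice Λ
  open LatticeFacts Λ
  open PseudoUltrametrics.Balls Λ pu

  _~_ : X → X → Set
  _~_ = EqRel Λ δ e

  _⊑_ : X → X → Set
  x ⊑ y = x ~ y ⊎ x < y

  Comparable : X → X → Set
  Comparable = Apart e f

  <-within : ∀ {x y} → x < y → EqRel Λ δ f x y
  <-within = IsSubquotientOrder.within sq _ _

  total : ∀ x y → EqRel Λ δ f x y → x ~ y ⊎ (x < y ⊎ y < x)
  total = IsSubquotientOrder.total sq

  ~sym : ∀ {x y} → x ~ y → y ~ x
  ~sym = close-sym

  ~trans : ∀ {x y z} → x ~ y → y ~ z → x ~ z
  ~trans = close-trans

  resp-l : ∀ {x x′ y} → x ~ x′ → x < y → x′ < y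
  resp-l {x} {x′} {y} h = IsSubquotientOrder.respects sq x x′ y y h (close-refl e y)

  resp-r : ∀ {x y y′} → y ~ y′ → x < y → x < y′
  resp-r {x} {y} {y′} h = IsSubquotientOrder.respects sq x x y y′ (close-refl e x) h

  <-trans : ∀ {x y z} → x < y → y < z → x < z
  <-trans = IsSubquotientOrder.trans sq _ _ _

  irr : ∀ {x y} → x < y → ¬ (x ~ y)
  irr = IsSubquotientOrder.irrefl sq _ _

  strict⇒apart : ∀ {x y} → x < y ⊎ y < x → Comparable x y
  strict⇒apart (inj₁ o) = <-within o , irr o
  strict⇒apart (inj₂ o) = close-sym (<-within o) , λ h → irr o (~sym h)

  apart⇒strict : ∀ {x y} → Comparable x y → x < y ⊎ y < x
  apart⇒strict {x} {y} (≤f , ≁) with total x y ≤f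
  ... | inj₁ h = ⊥-elim (≁ h)
  ... | inj₂ s = s

  ⊑-refl : ∀ {x} → x ⊑ x
  ⊑-refl = inj₁ (close-refl e _)

  <⊑ : ∀ {x y z} → x < y → y ⊑ z → x < z
  <⊑ o (inj₁ h) = resp-r h o
  <⊑ o (inj₂ o′) = <-trans o o′

  ⊑< : ∀ {x y z} → x ⊑ y → y < z → x < z
  ⊑< (inj₁ h) o = resp-l (~sym h) o
  ⊑< (inj₂ o) o′ = <-trans o o′

  ⊑-trans : ∀ {x y z} → x ⊑ y → y ⊑ z → x ⊑ z
  ⊑-trans (inj₁ h) (inj₁ h′) = inj₁ (~trans h h′)
  ⊑-trans p (inj₂ o) = inj₂ (⊑< p o)
  ⊑-trans (inj₂ o) (inj₁ h) = inj₂ (resp-r h o)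

  ⊑~ : ∀ {x y z} → x ⊑ y → y ~ z → x ⊑ z
  ⊑~ p h = ⊑-trans p (inj₁ h)

  ~⊑ : ∀ {x y z} → x ~ y → y ⊑ z → x ⊑ z
  ~⊑ h p = ⊑-trans (inj₁ h) p

  ⊑-apart⇒< : ∀ {x y} → x ⊑ y → ¬ (x ~ y) → x < y
  ⊑-apart⇒< (inj₁ h) ≁ = ⊥-elim (≁ h)
  ⊑-apart⇒< (inj₂ o) ≁ = o

  <⊑-absurd : ∀ {x y} → x < y → y ⊑ x → ⊥
  <⊑-absurd o p = irr (<⊑ o p) (close-refl e _)

  top-absurd : ∀ {x y} → 𝟙 ≤ e → x < y → ⊥
  top-absurd t o = irr o (trans (𝟙-great _) t)

  -- Totality makes ⊑ decidable (using decidability of ≤ in Λ).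
  ⊑-dec : ∀ x y → Dec (x ⊑ y)
  ⊑-dec x y with ≤-dec (δ x y) f
  ... | no δ≰f = no (λ { (inj₁ h) → δ≰f (trans h e≤f)
                        ; (inj₂ o) → δ≰f (<-within o) })
  ... | yes δ≤f with total x y δ≤f
  ...   | inj₁ h = yes (inj₁ h)
  ...   | inj₂ (inj₁ o) = yes (inj₂ o)
  ...   | inj₂ (inj₂ o) = no (<⊑-absurd o)

pullback-SQ : (Λ : FiniteDistLattice) {X Y : Set} (g : Y → X)
  {δ : X → X → FiniteDistLattice.Carrier Λ} {e f : FiniteDistLattice.Carrier Λ}
  {_<_ : X → X → Set} → IsSubquotientOrder Λ δ e f _<_ →
  IsSubquotientOrder Λ (λ a b → δ (g a) (g b)) e f (λ a b → g a < g b)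
pullback-SQ Λ g sq = record
  { respects = λ a a′ b b′ → respects (g a) (g a′) (g b) (g b′)
  ; irrefl   = λ a b → irrefl (g a) (g b)
  ; trans    = λ a b c → trans (g a) (g b) (g c)
  ; within   = λ a b → within (g a) (g b)
  ; total    = λ a b → total (g a) (g b) }
  where open IsSubquotientOrder sq

module Collapse (Λ : FiniteDistLattice) (n : ℕ)
                (E F : Fin n → FiniteDistLattice.Carrier Λ) where
  open FiniteDistLattice Λ
  open LatticeFacts Λ
  open PseudoUltrametrics Λ

  record PseudoStr : Set₁ where
    field
      Pt         : Set
      count      : ℕ
      enum       : Fin count → Pt
      index      : Pt → Fin count
      enum-index : ∀ u → enum (index u) ≡ u
      dist       : Pt → Pt → Carrier
      isPseudo   : IsPseudoUltrametric dist
      order      : Fin n → Pt → Pt → Set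
      order-SQ   : ∀ i → IsSubquotientOrder Λ dist (E i) (F i) (order i)

  module _ (P : PseudoStr) where
    open PseudoStr P
    open IsPseudoUltrametric isPseudo
    open Balls isPseudo

    private
      Q : FiniteQuotient count (λ j j′ → enum j ≐ enum j′)
      Q = finiteQuotient count _ (λ j j′ → ≤-dec _ _) (λ j → self (enum j))
            (λ j j′ → close-sym) (λ j j′ j″ → close-trans)
      module Q = FiniteQuotient Q

    point : Fin Q.classes → Pt
    point c = enum (Q.rep c)

    collapse : Str Λ n E F
    collapse = record
      { size    = Q.classes
      ; d       = λ c c′ → dist (point c) (point c′)
      ; isUltra = record
          { zero-iff = λ c c′ → mk⇔ (λ h → Q.rep-injective c c′ (reflexive h))
                                      (λ { ≡.refl → ≤𝟘⇒≈𝟘 (self (point c)) })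
          ; symm     = λ c c′ → symm (point c) (point c′)
          ; ultra    = λ c c′ c″ → ultra (point c) (point c′) (point c″) }
      ; ord     = λ i c c′ → order i (point c) (point c′)
      ; isSQ    = λ i → pullback-SQ Λ point (order-SQ i) }

    π : Pt → Fin Q.classes
    π u = Q.class (index u)

    point-π : ∀ u → point (π u) ≐ u
    point-π u = ≡.subst (λ w → point (π u) ≐ w) (enum-index u) (Q.rep-class (index u))

    π-identifies : ∀ {u v} → u ≐ v → π u ≡ π v
    π-identifies {u} {v} h =
      Q.rep-injective (π u) (π v) (close-trans (point-π u) (close-trans h (close-sym (point-π v))))

    order-≐ : ∀ i {u u′ v v′} → u ≐ u′ → v ≐ v′ → order i u v → order i u′ v′
    order-≐ i {u} {u′} {v} {v′} hu hv =
      IsSubquotientOrder.respects (order-SQ i) u u′ v v′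
        (≐⇒close (E i) hu) (≐⇒close (E i) hv)

    embedInCollapse : (A : Str Λ n E F) (j : Fin (size A) → Pt) →
      (∀ x y → dist (j x) (j y) ≈ d A x y) →
      (∀ i x y → ord A i x y ⇔ order i (j x) (j y)) →
      Embedding Λ n E F A collapse
    embedInCollapse A j j-dist j-ord = record
      { fun      = π ∘ j
      ; d-pres   = λ x y → Eq.trans (dist-≐ (point-π (j x)) (point-π (j y))) (j-dist x y)
      ; ord-pres = λ i x y → mk⇔
          (λ o → order-≐ i (close-sym (point-π (j x))) (close-sym (point-π (j y)))
                   (Equivalence.to (j-ord i x y) o))
          (λ o → Equivalence.from (j-ord i x y) (order-≐ i (point-π (j x)) (point-π (j y)) o)) }

module StrToolkit (Λ : FiniteDistLattice) (n : ℕ) (E F : Fin n → FiniteDistLattice.Carrier Λ)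
  (E≤F : ∀ i → FiniteDistLattice._≤_ Λ (E i) (F i)) (A : Str Λ n E F) (i : Fin n) =
  SubquotientToolkit Λ (PseudoUltrametrics.ultrametric⇒pseudo Λ (isUltra A)) (E≤F i) (isSQ A i)

module Transfer (Λ : FiniteDistLattice) (n : ℕ) (E F : Fin n → FiniteDistLattice.Carrier Λ)
  (E≤F : ∀ i → FiniteDistLattice._≤_ Λ (E i) (F i))
  {A B : Str Λ n E F} (g : Embedding Λ n E F A B) (i : Fin n) where
  open FiniteDistLattice Λ
  private
    module TA = StrToolkit Λ n E F E≤F A i
    module TB = StrToolkit Λ n E F E≤F B i

  <-to : ∀ {x y} → ord A i x y → ord B i (fun g x) (fun g y)
  <-to = Equivalence.to (ord-pres g i _ _)

  <-from : ∀ {x y} → ord B i (fun g x) (fun g y) → ord A i x y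
  <-from = Equivalence.from (ord-pres g i _ _)

  ⊑-to : ∀ {x y} → x TA.⊑ y → fun g x TB.⊑ fun g y
  ⊑-to (inj₁ h) = inj₁ (trans (reflexive (d-pres g _ _)) h)
  ⊑-to (inj₂ o) = inj₂ (<-to o)

  ⊑-from : ∀ {x y} → fun g x TB.⊑ fun g y → x TA.⊑ y
  ⊑-from (inj₁ h) = inj₁ (trans (reflexive (Eq.sym (d-pres g _ _))) h)
  ⊑-from (inj₂ o) = inj₂ (<-from o)

module Amalgam (Λ : FiniteDistLattice) (n : ℕ) (E F : Fin n → FiniteDistLattice.Carrier Λ)
  (E≤F : ∀ i → FiniteDistLattice._≤_ Λ (E i) (F i))
  (irreducible : ∀ i → MeetIrreducible Λ (E i))
  (A₀ A₁ A₂ : Str Λ n E F)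
  (f₁ : Embedding Λ n E F A₀ A₁) (f₂ : Embedding Λ n E F A₀ A₂) where
  open FiniteDistLattice Λ
  open LatticeFacts Λ
  open PseudoUltrametrics Λ
  open Collapse Λ n E F

  X₀ X₁ X₂ : Set
  X₀ = Fin (size A₀)
  X₁ = Fin (size A₁)
  X₂ = Fin (size A₂)

  private
    d₁ : X₁ → X₁ → Carrier
    d₁ = d A₁
    d₂ : X₂ → X₂ → Carrier
    d₂ = d A₂
    h₁ : X₀ → X₁
    h₁ = fun f₁
    h₂ : X₀ → X₂
    h₂ = fun f₂
    module U₁ = IsPseudoUltrametric (ultrametric⇒pseudo (isUltra A₁))
    module U₂ = IsPseudoUltrametric (ultrametric⇒pseudo (isUltra A₂))

    d₁-sym : ∀ x x′ → d₁ x x′ ≤ d₁ x′ x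
    d₁-sym x x′ = reflexive (U₁.symm x x′)
    d₂-sym : ∀ y y′ → d₂ y y′ ≤ d₂ y′ y
    d₂-sym y y′ = reflexive (U₂.symm y y′)

  d₁≤d₂ : ∀ a b → d₁ (h₁ a) (h₁ b) ≤ d₂ (h₂ a) (h₂ b)
  d₁≤d₂ a b = reflexive (Eq.trans (d-pres f₁ a b) (Eq.sym (d-pres f₂ a b)))

  d₂≤d₁ : ∀ a b → d₂ (h₂ a) (h₂ b) ≤ d₁ (h₁ a) (h₁ b)
  d₂≤d₁ a b = reflexive (Eq.trans (d-pres f₂ a b) (Eq.sym (d-pres f₁ a b)))

  via : X₁ → X₂ → X₀ → Carrier
  via x y a = d₁ x (h₁ a) ∨ d₂ (h₂ a) y

  cross : X₁ → X₂ → Carrier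
  cross x y = ⋀ (via x y)

  cross≤via : ∀ x y a → cross x y ≤ via x y a
  cross≤via x y a = ⋀-lowerBound (via x y) a

  cross-ultra₁₁₂ : ∀ x x′ y → cross x y ≤ d₁ x x′ ∨ cross x′ y
  cross-ultra₁₁₂ x x′ y =
    ≤∨-swap (cross x′ y) (d₁ x x′) (⋀-∨-bound (via x′ y) (cross x y) (d₁ x x′) λ a →
    ∨-bound (cross≤via x y a)
      (∨-bound (U₁.ultra x x′ (h₁ a)) (≤∨ʳ refl) (≤∨ˡ (≤∨ˡ refl)))
      (≤∨ˡ (≤∨ʳ refl)))

  cross-ultra₁₂₂ : ∀ x y y′ → cross x y′ ≤ cross x y ∨ d₂ y y′
  cross-ultra₁₂₂ x y y′ = ⋀-∨-bound (via x y) (cross x y′) (d₂ y y′) λ a →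
    ∨-bound (cross≤via x y′ a) (≤∨ˡ (≤∨ˡ refl))
      (∨-bound (U₂.ultra (h₂ a) y y′) (≤∨ˡ (≤∨ʳ refl)) (≤∨ʳ refl))

  cross-ultra₁₂₁ : ∀ x y x′ → d₁ x x′ ≤ cross x y ∨ cross x′ y
  cross-ultra₁₂₁ x y x′ = ⋀-∨-bound (via x y) (d₁ x x′) (cross x′ y) λ a →
    ≤∨-swap (cross x′ y) (via x y a) (⋀-∨-bound (via x′ y) (d₁ x x′) (via x y a) λ b →
      ∨-bound (U₁.ultra x (h₁ a) x′) (≤∨ʳ (≤∨ˡ refl))
        (∨-bound (U₁.ultra (h₁ a) (h₁ b) x′)
          (trans (d₁≤d₂ a b)
            (∨-bound (U₂.ultra (h₂ a) y (h₂ b)) (≤∨ʳ (≤∨ʳ refl)) (≤∨ˡ (≤∨ʳ (d₂-sym _ _)))))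
          (≤∨ˡ (≤∨ˡ (d₁-sym _ _)))))

  cross-ultra₂₁₂ : ∀ y x y′ → d₂ y y′ ≤ cross x y ∨ cross x y′
  cross-ultra₂₁₂ y x y′ = ⋀-∨-bound (via x y) (d₂ y y′) (cross x y′) λ a →
    ≤∨-swap (cross x y′) (via x y a) (⋀-∨-bound (via x y′) (d₂ y y′) (via x y a) λ b →
      ∨-bound (U₂.ultra y (h₂ a) y′) (≤∨ʳ (≤∨ʳ (d₂-sym _ _)))
        (∨-bound (U₂.ultra (h₂ a) (h₂ b) y′)
          (trans (d₂≤d₁ a b)
            (∨-bound (U₁.ultra (h₁ a) x (h₁ b)) (≤∨ʳ (≤∨ˡ (d₁-sym _ _))) (≤∨ˡ (≤∨ˡ refl))))
          (≤∨ˡ (≤∨ʳ refl))))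

  Pt : Set
  Pt = X₁ ⊎ X₂

  dist : Pt → Pt → Carrier
  dist (inj₁ x) (inj₁ x′) = d₁ x x′
  dist (inj₂ y) (inj₂ y′) = d₂ y y′
  dist (inj₁ x) (inj₂ y) = cross x y
  dist (inj₂ y) (inj₁ x) = cross x y

  dist-ultra : ∀ p q r → dist p r ≤ dist p q ∨ dist q r
  dist-ultra (inj₁ x) (inj₁ x′) (inj₁ x″) = U₁.ultra x x′ x″
  dist-ultra (inj₂ y) (inj₂ y′) (inj₂ y″) = U₂.ultra y y′ y″
  dist-ultra (inj₁ x) (inj₁ x′) (inj₂ y) = cross-ultra₁₁₂ x x′ y
  dist-ultra (inj₁ x) (inj₂ y) (inj₂ y′) = cross-ultra₁₂₂ x y y′
  dist-ultra (inj₁ x) (inj₂ y) (inj₁ x′) = cross-ultra₁₂₁ x y x′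
  dist-ultra (inj₂ y) (inj₁ x) (inj₂ y′) = cross-ultra₂₁₂ y x y′
  dist-ultra (inj₂ y) (inj₁ x) (inj₁ x′) =
    ∨-bound (cross-ultra₁₁₂ x′ x y) (≤∨ʳ (d₁-sym _ _)) (≤∨ˡ refl)
  dist-ultra (inj₂ y) (inj₂ y′) (inj₁ x) =
    ∨-bound (cross-ultra₁₂₂ x y′ y) (≤∨ʳ refl) (≤∨ˡ (d₂-sym _ _))

  dist-isPseudo : IsPseudoUltrametric dist
  dist-isPseudo = record { self = self ; symm = symm ; ultra = dist-ultra }
    where
    self : ∀ p → dist p p ≤ 𝟘
    self (inj₁ x) = U₁.self x
    self (inj₂ y) = U₂.self y
    symm : ∀ p q → dist p q ≈ dist q p
    symm (inj₁ x) (inj₁ x′) = U₁.symm x x′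
    symm (inj₂ y) (inj₂ y′) = U₂.symm y y′
    symm (inj₁ x) (inj₂ y) = Eq.refl
    symm (inj₂ y) (inj₁ x) = Eq.refl

  open Balls dist-isPseudo

  glue : ∀ a → inj₁ (h₁ a) ≐ inj₂ (h₂ a)
  glue a = trans (cross≤via (h₁ a) (h₂ a) a) (∨-least (U₁.self _) (U₂.self _))

  module CrossOrder (i : Fin n) where
    private
      e f : Carrier
      e = E i
      f = F i
      module O₁ = StrToolkit Λ n E F E≤F A₁ i
      module O₂ = StrToolkit Λ n E F E≤F A₂ i
      module T₁ = Transfer Λ n E F E≤F f₁ i
      module T₂ = Transfer Λ n E F E≤F f₂ i

    ⊑-across₁₂ : ∀ {a b} → h₁ a O₁.⊑ h₁ b → h₂ a O₂.⊑ h₂ b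
    ⊑-across₁₂ p = T₂.⊑-to (T₁.⊑-from p)

    ⊑-across₂₁ : ∀ {a b} → h₂ a O₂.⊑ h₂ b → h₁ a O₁.⊑ h₁ b
    ⊑-across₂₁ p = T₁.⊑-to (T₂.⊑-from p)

    <-across₁₂ : ∀ {a b} → ord A₁ i (h₁ a) (h₁ b) → ord A₂ i (h₂ a) (h₂ b)
    <-across₁₂ p = T₂.<-to (T₁.<-from p)

    Below : X₂ → X₁ → Set
    Below y x = ∃[ a ] (y O₂.⊑ h₂ a × h₁ a O₁.⊑ x)

    Below-dec : ∀ y x → Dec (Below y x)
    Below-dec y x = any? (λ a → O₂.⊑-dec y (h₂ a) ×-dec O₁.⊑-dec (h₁ a) x)

    Below-congˡ : ∀ {y y′ x} → y′ O₂.~ y → Below y x → Below y′ x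
    Below-congˡ h (a , ya , ax) = a , O₂.~⊑ h ya , ax

    Below-congʳ : ∀ {y x x′} → x O₁.~ x′ → Below y x → Below y x′
    Below-congʳ h (a , ya , ax) = a , ya , O₁.⊑~ ax h

    -- The key use of meet-irreducibility: since e is meet-prime, an
    -- e-small cross distance is realised by a single route through A₀
    -- (unless e = 𝟙, when all orders are empty).
    cross-close : ∀ x y → cross x y ≤ e →
                  (∃[ a ] (x O₁.~ h₁ a × h₂ a O₂.~ y)) ⊎ 𝟙 ≤ e
    cross-close x y h
      with ⋀-prime e (meetIrreducible⇒meetPrime e (irreducible i)) (via x y) h
    ... | inj₁ (a , p) = inj₁ (a , trans (x≤x∨y _ _) p , trans (y≤x∨y _ _) p)
    ... | inj₂ q = inj₂ q

    glued₁₂ : ∀ a → EqRel Λ dist e (inj₁ (h₁ a)) (inj₂ (h₂ a))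
    glued₁₂ a = ≐⇒close e {inj₁ (h₁ a)} {inj₂ (h₂ a)} (glue a)

    glued₂₁ : ∀ a → EqRel Λ dist e (inj₂ (h₂ a)) (inj₁ (h₁ a))
    glued₂₁ a = close-sym {x = inj₁ (h₁ a)} {inj₂ (h₂ a)} (glued₁₂ a)

    order : Pt → Pt → Set
    order (inj₁ x) (inj₁ x′) = ord A₁ i x x′
    order (inj₂ y) (inj₂ y′) = ord A₂ i y y′
    order (inj₁ x) (inj₂ y) = Apart e f (inj₁ x) (inj₂ y) × ¬ Below y x
    order (inj₂ y) (inj₁ x) = Apart e f (inj₂ y) (inj₁ x) × Below y x

    order⇒apart : ∀ p q → order p q → Apart e f p q
    order⇒apart (inj₁ x) (inj₁ x′) o = O₁.strict⇒apart (inj₁ o)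
    order⇒apart (inj₂ y) (inj₂ y′) o = O₂.strict⇒apart (inj₁ o)
    order⇒apart (inj₁ x) (inj₂ y) o = proj₁ o
    order⇒apart (inj₂ y) (inj₁ x) o = proj₁ o

    order-top : ∀ p q → 𝟙 ≤ e → order p q → ⊥
    order-top p q t o = proj₂ (order⇒apart p q o) (trans (𝟙-great _) t)

    order-total : ∀ p q → EqRel Λ dist f p q →
                  EqRel Λ dist e p q ⊎ (order p q ⊎ order q p)
    order-total (inj₁ x) (inj₁ x′) h = O₁.total x x′ h
    order-total (inj₂ y) (inj₂ y′) h = O₂.total y y′ h
    order-total (inj₁ x) (inj₂ y) h with ≤-dec (cross x y) e | Below-dec y x
    ... | yes close | _         = inj₁ close
    ... | no ≰e     | yes below = inj₂ (inj₂ ((h , ≰e) , below))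
    ... | no ≰e     | no ¬below = inj₂ (inj₁ ((h , ≰e) , ¬below))
    order-total (inj₂ y) (inj₁ x) h with ≤-dec (cross x y) e | Below-dec y x
    ... | yes close | _         = inj₁ close
    ... | no ≰e     | yes below = inj₂ (inj₁ ((h , ≰e) , below))
    ... | no ≰e     | no ¬below = inj₂ (inj₂ ((h , ≰e) , ¬below))

    -- Transitivity through points of both sides; indices name the sides
    -- of the three points.
    trans₁₁₂ : ∀ {x x′ y} → ord A₁ i x x′ → order (inj₁ x′) (inj₂ y) → order (inj₁ x) (inj₂ y)
    trans₁₁₂ {x} {x′} {y} o ((≤f , _) , ¬below) =
      (∨-bound (cross-ultra₁₁₂ x x′ y) (O₁.<-within o) ≤f , ≰e) , ¬below′
      where
      ≰e : ¬ (cross x y ≤ e)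
      ≰e h with cross-close x y h
      ... | inj₁ (a , xa , ay) = ¬below (a , inj₁ (O₂.~sym ay) , inj₂ (O₁.resp-l xa o))
      ... | inj₂ t = O₁.top-absurd t o
      ¬below′ : ¬ Below y x
      ¬below′ (a , ya , ax) = ¬below (a , ya , inj₂ (O₁.⊑< ax o))

    trans₁₂₁ : ∀ {x y x′} → order (inj₁ x) (inj₂ y) → order (inj₂ y) (inj₁ x′) → ord A₁ i x x′
    trans₁₂₁ {x} {y} {x′} ((≤f , _) , ¬below) ((≤f′ , _) , (a , ya , ax′))
      with O₁.total x x′ (∨-bound (cross-ultra₁₂₁ x y x′) ≤f ≤f′)
    ... | inj₁ xx′ = ⊥-elim (¬below (a , ya , O₁.⊑~ ax′ (O₁.~sym xx′)))
    ... | inj₂ (inj₁ lt) = lt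
    ... | inj₂ (inj₂ gt) = ⊥-elim (¬below (a , ya , inj₂ (O₁.⊑< ax′ gt)))

    trans₁₂₂ : ∀ {x y y′} → order (inj₁ x) (inj₂ y) → ord A₂ i y y′ → order (inj₁ x) (inj₂ y′)
    trans₁₂₂ {x} {y} {y′} ((≤f , _) , ¬below) o =
      (∨-bound (cross-ultra₁₂₂ x y y′) ≤f (O₂.<-within o) , ≰e) , ¬below′
      where
      ≰e : ¬ (cross x y′ ≤ e)
      ≰e h with cross-close x y′ h
      ... | inj₁ (a , xa , ay′) =
            ¬below (a , inj₂ (O₂.<⊑ o (inj₁ (O₂.~sym ay′))) , inj₁ (O₁.~sym xa))
      ... | inj₂ t = O₂.top-absurd t o
      ¬below′ : ¬ Below y′ x
      ¬below′ (a , y′a , ax) = ¬below (a , inj₂ (O₂.<⊑ o y′a) , ax)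

    trans₂₁₁ : ∀ {y x x′} → order (inj₂ y) (inj₁ x) → ord A₁ i x x′ → order (inj₂ y) (inj₁ x′)
    trans₂₁₁ {y} {x} {x′} ((≤f , _) , (a , ya , ax)) o =
      (∨-bound (dist-ultra (inj₂ y) (inj₁ x) (inj₁ x′)) ≤f (O₁.<-within o) , ≰e)
      , (a , ya , inj₂ (O₁.⊑< ax o))
      where
      ≰e : ¬ (cross x′ y ≤ e)
      ≰e h with cross-close x′ y h
      ... | inj₁ (b , x′b , by) =
            O₂.<⊑-absurd (<-across₁₂ (O₁.⊑< ax (O₁.<⊑ o (inj₁ x′b))))
                         (O₂.⊑-trans (inj₁ by) ya)
      ... | inj₂ t = O₁.top-absurd t o

    trans₂₁₂ : ∀ {y x y′} → order (inj₂ y) (inj₁ x) → order (inj₁ x) (inj₂ y′) → ord A₂ i y y′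
    trans₂₁₂ {y} {x} {y′} ((≤f , _) , (a , ya , ax)) ((≤f′ , _) , ¬below)
      with O₂.total y y′ (∨-bound (cross-ultra₂₁₂ y x y′) ≤f ≤f′)
    ... | inj₁ yy′ = ⊥-elim (¬below (a , O₂.~⊑ (O₂.~sym yy′) ya , ax))
    ... | inj₂ (inj₁ lt) = lt
    ... | inj₂ (inj₂ gt) = ⊥-elim (¬below (a , inj₂ (O₂.<⊑ gt ya) , ax))

    trans₂₂₁ : ∀ {y y′ x} → ord A₂ i y y′ → order (inj₂ y′) (inj₁ x) → order (inj₂ y) (inj₁ x)
    trans₂₂₁ {y} {y′} {x} o ((≤f , _) , (a , y′a , ax)) =
      (∨-bound (dist-ultra (inj₂ y) (inj₂ y′) (inj₁ x)) (O₂.<-within o) ≤f , ≰e)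
      , (a , inj₂ (O₂.<⊑ o y′a) , ax)
      where
      ≰e : ¬ (cross x y ≤ e)
      ≰e h with cross-close x y h
      ... | inj₁ (b , xb , by) =
            O₂.<⊑-absurd (O₂.<⊑ (O₂.resp-l (O₂.~sym by) o) y′a)
                         (⊑-across₁₂ (O₁.⊑~ ax xb))
      ... | inj₂ t = O₂.top-absurd t o

    order-trans : ∀ p q r → order p q → order q r → order p r
    order-trans (inj₁ _) (inj₁ _) (inj₁ _) = O₁.<-trans
    order-trans (inj₂ _) (inj₂ _) (inj₂ _) = O₂.<-trans
    order-trans (inj₁ _) (inj₁ _) (inj₂ _) = trans₁₁₂
    order-trans (inj₁ _) (inj₂ _) (inj₁ _) = trans₁₂₁
    order-trans (inj₁ _) (inj₂ _) (inj₂ _) = trans₁₂₂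
    order-trans (inj₂ _) (inj₁ _) (inj₁ _) = trans₂₁₁
    order-trans (inj₂ _) (inj₁ _) (inj₂ _) = trans₂₁₂
    order-trans (inj₂ _) (inj₂ _) (inj₁ _) = trans₂₂₁

    apartˡ : ∀ p p′ q → EqRel Λ dist e p p′ → Apart e f p q → Apart e f p′ q
    apartˡ p p′ q = apart-congˡ {x = p} {p′} {q} (E≤F i)

    apartʳ : ∀ p q q′ → EqRel Λ dist e q q′ → Apart e f p q → Apart e f p q′
    apartʳ p q q′ = apart-congʳ {x = p} {q} {q′} (E≤F i)

    respˡ₁ : ∀ {x x′} q → x O₁.~ x′ → order (inj₁ x) q → order (inj₁ x′) q
    respˡ₁ (inj₁ z) h o = O₁.resp-l h o
    respˡ₁ {x} {x′} (inj₂ y) h (ap , ¬below) =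
      apartˡ (inj₁ x) (inj₁ x′) (inj₂ y) h ap
      , λ below → ¬below (Below-congʳ (O₁.~sym h) below)

    respˡ₂ : ∀ {y y′} q → y O₂.~ y′ → order (inj₂ y) q → order (inj₂ y′) q
    respˡ₂ (inj₂ z) h o = O₂.resp-l h o
    respˡ₂ {y} {y′} (inj₁ x) h (ap , below) =
      apartˡ (inj₂ y) (inj₂ y′) (inj₁ x) h ap , Below-congˡ (O₂.~sym h) below

    respʳ₁ : ∀ p {x x′} → x O₁.~ x′ → order p (inj₁ x) → order p (inj₁ x′)
    respʳ₁ (inj₁ z) h o = O₁.resp-r h o
    respʳ₁ (inj₂ y) {x} {x′} h (ap , below) =
      apartʳ (inj₂ y) (inj₁ x) (inj₁ x′) h ap , Below-congʳ h below

    respʳ₂ : ∀ p {y y′} → y O₂.~ y′ → order p (inj₂ y) → order p (inj₂ y′)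
    respʳ₂ (inj₂ z) h o = O₂.resp-r h o
    respʳ₂ (inj₁ x) {y} {y′} h (ap , ¬below) =
      apartʳ (inj₁ x) (inj₂ y) (inj₂ y′) h ap , λ below → ¬below (Below-congˡ h below)

    swapˡ₁₂ : ∀ a q → order (inj₁ (h₁ a)) q → order (inj₂ (h₂ a)) q
    swapˡ₁₂ a (inj₁ x) o =
      apartˡ (inj₁ (h₁ a)) (inj₂ (h₂ a)) (inj₁ x) (glued₁₂ a) (O₁.strict⇒apart (inj₁ o))
      , (a , O₂.⊑-refl , inj₂ o)
    swapˡ₁₂ a (inj₂ y) (ap , ¬below)
      with O₂.apart⇒strict (apartˡ (inj₁ (h₁ a)) (inj₂ (h₂ a)) (inj₂ y) (glued₁₂ a) ap)
    ... | inj₁ lt = lt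
    ... | inj₂ gt = ⊥-elim (¬below (a , inj₂ gt , O₁.⊑-refl))

    swapˡ₂₁ : ∀ a q → order (inj₂ (h₂ a)) q → order (inj₁ (h₁ a)) q
    swapˡ₂₁ a (inj₂ y) o =
      apartˡ (inj₂ (h₂ a)) (inj₁ (h₁ a)) (inj₂ y) (glued₂₁ a) (O₂.strict⇒apart (inj₁ o))
      , λ { (b , yb , ba) → O₂.<⊑-absurd o (O₂.⊑-trans yb (⊑-across₁₂ ba)) }
    swapˡ₂₁ a (inj₁ x) (ap , (b , ab , bx)) =
      O₁.⊑-apart⇒< (O₁.⊑-trans (⊑-across₂₁ ab) bx)
        (proj₂ (apartˡ (inj₂ (h₂ a)) (inj₁ (h₁ a)) (inj₁ x) (glued₂₁ a) ap))

    swapʳ₁₂ : ∀ a p → order p (inj₁ (h₁ a)) → order p (inj₂ (h₂ a))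
    swapʳ₁₂ a (inj₁ x) o =
      apartʳ (inj₁ x) (inj₁ (h₁ a)) (inj₂ (h₂ a)) (glued₁₂ a) (O₁.strict⇒apart (inj₁ o))
      , λ { (b , ab , bx) → O₁.<⊑-absurd o (O₁.⊑-trans (⊑-across₂₁ ab) bx) }
    swapʳ₁₂ a (inj₂ y) (ap , (b , yb , ba)) =
      O₂.⊑-apart⇒< (O₂.⊑-trans yb (⊑-across₁₂ ba))
        (proj₂ (apartʳ (inj₂ y) (inj₁ (h₁ a)) (inj₂ (h₂ a)) (glued₁₂ a) ap))

    swapʳ₂₁ : ∀ a p → order p (inj₂ (h₂ a)) → order p (inj₁ (h₁ a))
    swapʳ₂₁ a (inj₂ y) o =
      apartʳ (inj₂ y) (inj₂ (h₂ a)) (inj₁ (h₁ a)) (glued₂₁ a) (O₂.strict⇒apart (inj₁ o))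
      , (a , inj₂ o , O₁.⊑-refl)
    swapʳ₂₁ a (inj₁ x) (ap , ¬below)
      with O₁.apart⇒strict (apartʳ (inj₁ x) (inj₂ (h₂ a)) (inj₁ (h₁ a)) (glued₂₁ a) ap)
    ... | inj₁ lt = lt
    ... | inj₂ gt = ⊥-elim (¬below (a , O₂.⊑-refl , inj₂ gt))

    -- Moving a point within its Eᵢ-class across the two sides: by
    -- cross-close, go to the glued point, swap copies, and move on.
    respˡ : ∀ p p′ q → EqRel Λ dist e p p′ → order p q → order p′ q
    respˡ (inj₁ x) (inj₁ x′) q h = respˡ₁ q h
    respˡ (inj₂ y) (inj₂ y′) q h = respˡ₂ q h
    respˡ (inj₁ x) (inj₂ y) q h o with cross-close x y h
    ... | inj₁ (a , xa , ay) = respˡ₂ q ay (swapˡ₁₂ a q (respˡ₁ q xa o))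
    ... | inj₂ t = ⊥-elim (order-top (inj₁ x) q t o)
    respˡ (inj₂ y) (inj₁ x) q h o with cross-close x y h
    ... | inj₁ (a , xa , ay) =
          respˡ₁ q (O₁.~sym xa) (swapˡ₂₁ a q (respˡ₂ q (O₂.~sym ay) o))
    ... | inj₂ t = ⊥-elim (order-top (inj₂ y) q t o)

    respʳ : ∀ p q q′ → EqRel Λ dist e q q′ → order p q → order p q′
    respʳ p (inj₁ x) (inj₁ x′) h = respʳ₁ p h
    respʳ p (inj₂ y) (inj₂ y′) h = respʳ₂ p h
    respʳ p (inj₁ x) (inj₂ y) h o with cross-close x y h
    ... | inj₁ (a , xa , ay) = respʳ₂ p ay (swapʳ₁₂ a p (respʳ₁ p xa o))
    ... | inj₂ t = ⊥-elim (order-top p (inj₁ x) t o)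
    respʳ p (inj₂ y) (inj₁ x) h o with cross-close x y h
    ... | inj₁ (a , xa , ay) =
          respʳ₁ p (O₁.~sym xa) (swapʳ₂₁ a p (respʳ₂ p (O₂.~sym ay) o))
    ... | inj₂ t = ⊥-elim (order-top p (inj₂ y) t o)

    order-SQ : IsSubquotientOrder Λ dist e f order
    order-SQ = record
      { respects = λ p p′ q q′ hp hq o → respʳ p′ q q′ hq (respˡ p p′ q hp o)
      ; irrefl   = λ p q o → proj₂ (order⇒apart p q o)
      ; trans    = order-trans
      ; within   = λ p q o → proj₁ (order⇒apart p q o)
      ; total    = order-total }

  amalgam : PseudoStr
  amalgam = record
    { Pt         = Pt
    ; count      = size A₁ + size A₂
    ; enum       = splitAt (size A₁)
    ; index      = join (size A₁) (size A₂)
    ; enum-index = splitAt-join (size A₁) (size A₂)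
    ; dist       = dist
    ; isPseudo   = dist-isPseudo
    ; order      = CrossOrder.order
    ; order-SQ   = CrossOrder.order-SQ }

  C : Str Λ n E F
  C = collapse amalgam

  g₁ : Embedding Λ n E F A₁ C
  g₁ = embedInCollapse amalgam A₁ inj₁ (λ _ _ → Eq.refl) (λ _ _ _ → mk⇔ id id)

  g₂ : Embedding Λ n E F A₂ C
  g₂ = embedInCollapse amalgam A₂ inj₂ (λ _ _ → Eq.refl) (λ _ _ _ → mk⇔ id id)

  g-commute : ∀ a → fun g₁ (fun f₁ a) ≡ fun g₂ (fun f₂ a)
  g-commute a = π-identifies amalgam {inj₁ (h₁ a)} {inj₂ (h₂ a)} (glue a)

mainTheorem1 : (Λ : FiniteDistLattice) (n : ℕ)
    (E F : Fin n → FiniteDistLattice.Carrier Λ) →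
    (∀ i → FiniteDistLattice._≤_ Λ (E i) (F i)) →
    (∀ i → MeetIrreducible Λ (E i)) →
    Amalgamation Λ n E F
mainTheorem1 Λ n E F E≤F irreducible A₀ A₁ A₂ f₁ f₂ = C , g₁ , g₂ , g-commute
  where open Amalgam Λ n E F E≤F irreducible A₀ A₁ A₂ f₁ f₂
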